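{- Let $n>2$ be an integer and $r\ge1$ an integer with $2^r+1<2^n$, and let $s_i=(2^r+1)2^{n+i}+1$ for $i\in\mathbb{N}$. Then the Frobenius number of $P_{2^r+1}(n)$ is $\mathrm{F}(P_{2^r+1}(n))=2s_1+s_n+s_{n+r}-s_0$.
   Context: $P_{2^r+1}(n)$ is the numerical semigroup consisting of all finite non-negative integer linear combinations of $\{(2^r+1)2^{n+i}+1\mid i\in\mathbb{N}\}$. The Frobenius number $\mathrm{F}(S)$ of a numerical semigroup $S$ is the largest integer not in $S$. -}

module Defs where

open import Data.Nat using (ℕ; _+_; _*_; _^_; _<_)
open import Data.List using (List; map)
open import Data.Nat.ListAction using (sum)
open import Data.Product using (∃)
open import Relation.Binary.PropositionalEquality using (_≡_)
open import Relation.Nullary using (¬_)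

gen : ℕ → ℕ → ℕ → ℕ
gen r n i = (2 ^ r + 1) * 2 ^ (n + i) + 1

-- The numerical semigroup generated by a family g : ℕ → ℕ:
-- all finite non-negative integer linear combinations of the g i,
-- i.e. finite sums of generators (with repetition; empty sum = 0).
InSemigroup : (ℕ → ℕ) → ℕ → Set
InSemigroup g x = ∃ λ (is : List ℕ) → sum (map g is) ≡ x

P : ℕ → ℕ → ℕ → Set
P r n = InSemigroup (gen r n)

IsFrobeniusNumber : (ℕ → Set) → ℕ → Set
IsFrobeniusNumber S f = ¬ S f × (∀ m → f < m → S m)
  where open import Data.Product using (_×_)

{-# OPTIONS --safe #-}
-- With M = (2^r + 1) 2^n the generators are s_i = M 2^i + 1, so a sum of k of them is
-- k + M T with T a sum of k powers of two; once T has such a representation, every count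
-- up to T is reached by splitting 2^(e+1) = 2^e + 2^e.  For 3 + M (M + 3) this forces
-- T = M + 3 and k = 3, which is impossible: M = 4 · 2^(n-2) (2^r + 1) with 2^r + 1 odd and
-- greater than 1, so M + 3 has at least four binary digits.  Above it, every residue modulo
-- s_0 = M + 1 is hit by k + M (M + 3) with 4 ≤ k ≤ M + 3, using M + 3 = 2^(n+r) + 2^n + 2 + 1,
-- or by 4 + M (M + 4), using M + 4 = 2^(n+r) + 2^n + 2 + 2.
module Submission where

open import Defs
open import Data.Nat using (ℕ; zero; suc; _+_; _*_; _^_; _<_; _≤_; _∸_; z≤n; s≤s; s≤s⁻¹; z<s; >-nonZero; ≢-nonZero⁻¹)
open import Data.Nat.Properties
open import Data.Nat.DivMod using (_%_; _/_; m≡m%n+[m/n]*n; m%n<n)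
open import Data.Nat.ListAction using (sum)
open import Data.Nat.ListAction.Properties using (sum-++)
open import Data.Nat.Tactic.RingSolver using (solve-∀)
open import Data.List using (List; []; _∷_; _++_; map; length)
open import Data.List.Properties using (map-++; map-cong)
open import Data.Product using (∃; ∃₂; _×_; _,_)
open import Data.Sum using (inj₁; inj₂)
open import Relation.Binary.Definitions using (tri<; tri≈; tri>)
open import Relation.Binary.PropositionalEquality
open import Relation.Nullary using (¬_; contradiction)

sumPow2 : List ℕ → ℕ
sumPow2 es = sum (map (2 ^_) es)

Pow2Sum : ℕ → ℕ → Set
Pow2Sum k T = ∃ λ (es : List ℕ) → length es ≡ k × sumPow2 es ≡ T

length≤sumPow2 : ∀ es → length es ≤ sumPow2 es
length≤sumPow2 []       = z≤n
length≤sumPow2 (e ∷ es) = +-mono-≤ (m^n>0 2 e) (length≤sumPow2 es)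

pow2Sum⇒≤ : ∀ {k T} → Pow2Sum k T → k ≤ T
pow2Sum⇒≤ (es , refl , refl) = length≤sumPow2 es

sumPow2-refine : ∀ es → length es < sumPow2 es → Pow2Sum (suc (length es)) (sumPow2 es)
sumPow2-refine (zero ∷ es) (s≤s lt) with sumPow2-refine es lt
... | es′ , len , total = zero ∷ es′ , cong suc len , cong suc total
sumPow2-refine (suc e ∷ es) _ = e ∷ e ∷ es , refl , double (2 ^ e) (sumPow2 es)
  where
  double : ∀ x s → x + (x + s) ≡ 2 * x + s
  double = solve-∀

pow2Sum-suc : ∀ {k T} → Pow2Sum k T → k < T → Pow2Sum (suc k) T
pow2Sum-suc (es , refl , refl) = sumPow2-refine es

pow2Sum-raise : ∀ {k T} j → k ≤ j → j ≤ T → Pow2Sum k T → Pow2Sum j T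
pow2Sum-raise zero    z≤n   _     R = R
pow2Sum-raise (suc j) k≤1+j 1+j≤T R with m≤n⇒m<n∨m≡n k≤1+j
... | inj₂ refl      = R
... | inj₁ (s≤s k≤j) = pow2Sum-suc (pow2Sum-raise j k≤j (<⇒≤ 1+j≤T) R) 1+j≤T

module _ {g : ℕ → ℕ} where

  InSemigroup-gen : ∀ i → InSemigroup g (g i)
  InSemigroup-gen i = i ∷ [] , +-identityʳ (g i)

  InSemigroup-+ : ∀ {x y} → InSemigroup g x → InSemigroup g y → InSemigroup g (x + y)
  InSemigroup-+ (is , refl) (js , refl) =
    is ++ js , trans (cong sum (map-++ g is js)) (sum-++ (map g is) (map g js))

  InSemigroup-*gen : ∀ q i → InSemigroup g (q * g i)
  InSemigroup-*gen zero    i = [] , refl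
  InSemigroup-*gen (suc q) i = InSemigroup-+ (InSemigroup-gen i) (InSemigroup-*gen q i)

InSemigroup-≗ : ∀ {g h x} → g ≗ h → InSemigroup g x → InSemigroup h x
InSemigroup-≗ g≗h (is , eq) = is , trans (cong sum (sym (map-cong g≗h is))) eq

pow2Gen : ℕ → ℕ → ℕ
pow2Gen M i = M * 2 ^ i + 1

sum-pow2Gen : ∀ M is → sum (map (pow2Gen M) is) ≡ length is + M * sumPow2 is
sum-pow2Gen M []       = sym (*-zeroʳ M)
sum-pow2Gen M (i ∷ is) = begin
  M * 2 ^ i + 1 + sum (map (pow2Gen M) is)     ≡⟨ cong (M * 2 ^ i + 1 +_) (sum-pow2Gen M is) ⟩
  M * 2 ^ i + 1 + (length is + M * sumPow2 is) ≡⟨ regroup M (2 ^ i) (length is) (sumPow2 is) ⟩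
  suc (length is) + M * (2 ^ i + sumPow2 is)   ∎
  where
  open ≡-Reasoning
  regroup : ∀ M x l s → M * x + 1 + (l + M * s) ≡ suc l + M * (x + s)
  regroup = solve-∀

InSemigroup⇒pow2Sum : ∀ {M x} → InSemigroup (pow2Gen M) x → ∃₂ λ k T → Pow2Sum k T × k + M * T ≡ x
InSemigroup⇒pow2Sum {M} (is , eq) =
  length is , sumPow2 is , (is , refl , refl) , trans (sym (sum-pow2Gen M is)) eq

pow2Sum⇒InSemigroup : ∀ {M k T x} → Pow2Sum k T → k + M * T ≡ x → InSemigroup (pow2Gen M) x
pow2Sum⇒InSemigroup {M} (is , refl , refl) eq = is , trans (sum-pow2Gen M is) eq

module _ {M : ℕ} where

  k+M*T≡3+M*[3+M]⇒T≡3+M : ∀ {k T} → 4 ≤ M → k ≤ T → k + M * T ≡ 3 + M * (3 + M) → T ≡ 3 + M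
  k+M*T≡3+M*[3+M]⇒T≡3+M {k} {T} 4≤M k≤T eq with <-cmp T (3 + M)
  ... | tri≈ _ T≡3+M _ = T≡3+M
  ... | tri< T<3+M _ _ = contradiction eq (<⇒≢ (begin-strict
    k + M * T             ≤⟨ +-mono-≤ (≤-trans k≤T T≤2+M) (*-monoʳ-≤ M T≤2+M) ⟩
    2 + M + M * (2 + M)   <⟨ ≤-reflexive (next M) ⟩
    3 + M * (3 + M)       ∎))
    where
    open ≤-Reasoning
    T≤2+M = s≤s⁻¹ T<3+M
    next : ∀ M → suc (2 + M + M * (2 + M)) ≡ 3 + M * (3 + M)
    next = solve-∀
  ... | tri> _ _ T>3+M = contradiction eq (>⇒≢ (begin-strict
    3 + M * (3 + M)       <⟨ +-monoˡ-< (M * (3 + M)) 4≤M ⟩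
    M + M * (3 + M)       ≡⟨ *-suc M (3 + M) ⟨
    M * (4 + M)           ≤⟨ *-monoʳ-≤ M T>3+M ⟩
    M * T                 ≤⟨ m≤n+m (M * T) k ⟩
    k + M * T             ∎))
    where open ≤-Reasoning

  frobenius∉ : 4 ≤ M → ¬ Pow2Sum 3 (3 + M) → ¬ InSemigroup (pow2Gen M) (3 + M * (3 + M))
  frobenius∉ 4≤M no3 F∈ with InSemigroup⇒pow2Sum {M} F∈
  ... | k , T , R , eq with k+M*T≡3+M*[3+M]⇒T≡3+M 4≤M (pow2Sum⇒≤ R) eq
  ... | refl = no3 (subst (λ k → Pow2Sum k (3 + M)) (+-cancelʳ-≡ (M * (3 + M)) k 3 eq) R)

  module _ (three : Pow2Sum 4 (3 + M)) (four : Pow2Sum 4 (4 + M)) where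

    frobenius-successors∈ : ∀ ρ → ρ ≤ M → InSemigroup (pow2Gen M) (4 + ρ + M * (3 + M))
    frobenius-successors∈ ρ ρ≤M with m≤n⇒m<n∨m≡n ρ≤M
    ... | inj₁ ρ<M = pow2Sum⇒InSemigroup {M}
      (pow2Sum-raise (4 + ρ) (m≤m+n 4 ρ) (+-monoʳ-≤ 3 ρ<M) three) refl
    ... | inj₂ refl = pow2Sum⇒InSemigroup {M} four (cong (4 +_) (*-suc M (3 + M)))

    frobenius<∈ : ∀ x → 3 + M * (3 + M) < x → InSemigroup (pow2Gen M) x
    frobenius<∈ x F<x =
      subst (InSemigroup (pow2Gen M)) (sym x≡)
        (InSemigroup-+ (frobenius-successors∈ ρ (s≤s⁻¹ (m%n<n d (suc M)))) (InSemigroup-*gen q 0))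
      where
      open ≡-Reasoning
      d = x ∸ (4 + M * (3 + M))
      ρ = d % suc M
      q = d / suc M
      regroup : ∀ M ρ q → 4 + M * (3 + M) + (ρ + q * suc M) ≡ 4 + ρ + M * (3 + M) + q * (M * 1 + 1)
      regroup = solve-∀
      x≡ : x ≡ 4 + ρ + M * (3 + M) + q * pow2Gen M 0
      x≡ = begin
        x                                  ≡⟨ m+[n∸m]≡n F<x ⟨
        4 + M * (3 + M) + d                ≡⟨ cong (4 + M * (3 + M) +_) (m≡m%n+[m/n]*n d (suc M)) ⟩
        4 + M * (3 + M) + (ρ + q * suc M)  ≡⟨ regroup M ρ q ⟩
        4 + ρ + M * (3 + M) + q * pow2Gen M 0 ∎

pow2Gen-frobenius : ∀ {M} → 4 ≤ M → ¬ Pow2Sum 3 (3 + M) → Pow2Sum 4 (3 + M) → Pow2Sum 4 (4 + M) →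
  IsFrobeniusNumber (InSemigroup (pow2Gen M)) (3 + M * (3 + M))
pow2Gen-frobenius 4≤M no3 three four = frobenius∉ 4≤M no3 , frobenius<∈ three four

IsFrobeniusNumber-≗ : ∀ {g h f} → g ≗ h →
  IsFrobeniusNumber (InSemigroup g) f → IsFrobeniusNumber (InSemigroup h) f
IsFrobeniusNumber-≗ g≗h (f∉ , >f∈) =
  (λ f∈ → f∉ (InSemigroup-≗ (λ i → sym (g≗h i)) f∈)) , λ m f<m → InSemigroup-≗ g≗h (>f∈ m f<m)

pow2≢pow2*odd : ∀ {h} → 0 < h → ∀ a p → 2 ^ a ≢ 2 ^ p * suc (2 * h)
pow2≢pow2*odd z<s zero zero ()
pow2≢pow2*odd {h} _ (suc a) zero eq = even≢odd (2 ^ a) h (trans eq (*-identityˡ _))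
pow2≢pow2*odd {h} _ zero (suc p) eq =
  even≢odd (2 ^ p * suc (2 * h)) 0 (sym (trans eq (*-assoc 2 (2 ^ p) _)))
pow2≢pow2*odd h>0 (suc a) (suc p) eq =
  pow2≢pow2*odd h>0 a p (*-cancelˡ-≡ _ _ 2 (trans eq (*-assoc 2 (2 ^ p) _)))

pow2+pow2≢odd : ∀ {h} → 0 < h → ∀ p a b → 2 ^ a + 2 ^ b ≢ suc (2 * (2 ^ p * suc (2 * h)))
pow2+pow2≢odd {h} _ p zero zero eq = even≢odd 1 (2 ^ p * suc (2 * h)) eq
pow2+pow2≢odd h>0 p zero (suc b) eq =
  pow2≢pow2*odd h>0 b p (*-cancelˡ-≡ _ _ 2 (suc-injective eq))
pow2+pow2≢odd h>0 p (suc a) zero eq =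
  pow2≢pow2*odd h>0 a p (*-cancelˡ-≡ _ _ 2 (suc-injective (trans (+-comm 1 (2 ^ suc a)) eq)))
pow2+pow2≢odd {h} _ p (suc a) (suc b) eq =
  even≢odd (2 ^ a + 2 ^ b) (2 ^ p * suc (2 * h)) (trans (*-distribˡ-+ 2 (2 ^ a) (2 ^ b)) eq)

¬pow2Sum₃-odd : ∀ {h} → 0 < h → ∀ p → ¬ Pow2Sum 3 (suc (2 * suc (2 * (2 ^ p * suc (2 * h)))))
¬pow2Sum₃-odd {h} h>0 p (a ∷ b ∷ c ∷ [] , refl , eq) = three a b c eq
  where
  Q = 2 ^ p * suc (2 * h)
  Q≢0 : Q ≢ 0
  Q≢0 = ≢-nonZero⁻¹ Q {{m*n≢0 (2 ^ p) _ {{m^n≢0 2 p}}}}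
  1+1+2x : ∀ x → 2 * (1 + x) ≡ 1 + (1 + (2 * x + 0))
  1+1+2x = solve-∀
  1+2x+1 : ∀ x → 2 * (1 + x) ≡ 1 + (2 * x + (1 + 0))
  1+2x+1 = solve-∀
  2x+1+1 : ∀ x → 2 * (1 + x) ≡ 2 * x + (1 + (1 + 0))
  2x+1+1 = solve-∀
  2x+2y+2z : ∀ x y z → 2 * (x + y + z) ≡ 2 * x + (2 * y + (2 * z + 0))
  2x+2y+2z = solve-∀
  1+2y+2z : ∀ y z → suc (2 * (y + z)) ≡ 1 + (2 * y + (2 * z + 0))
  1+2y+2z = solve-∀
  2x+1+2z : ∀ x z → suc (2 * (x + z)) ≡ 2 * x + (1 + (2 * z + 0))
  2x+1+2z = solve-∀
  2x+2y+1 : ∀ x y → suc (2 * (x + y)) ≡ 2 * x + (2 * y + (1 + 0))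
  2x+2y+1 = solve-∀
  halve : ∀ {x} → suc (2 * x) ≡ suc (2 * suc (2 * Q)) → x ≡ suc (2 * Q)
  halve eq = *-cancelˡ-≡ _ _ 2 (suc-injective eq)
  three : ∀ a b c → 2 ^ a + (2 ^ b + (2 ^ c + 0)) ≢ suc (2 * suc (2 * Q))
  three zero zero zero eq = Q≢0 (sym (*-cancelˡ-≡ 0 Q 2 (suc-injective (halve eq))))
  three zero zero (suc c) eq = even≢odd (1 + 2 ^ c) (suc (2 * Q)) (trans (1+1+2x (2 ^ c)) eq)
  three zero (suc b) zero eq = even≢odd (1 + 2 ^ b) (suc (2 * Q)) (trans (1+2x+1 (2 ^ b)) eq)
  three (suc a) zero zero eq = even≢odd (1 + 2 ^ a) (suc (2 * Q)) (trans (2x+1+1 (2 ^ a)) eq)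
  three zero (suc b) (suc c) eq = pow2+pow2≢odd h>0 p b c (halve (trans (1+2y+2z (2 ^ b) (2 ^ c)) eq))
  three (suc a) zero (suc c) eq = pow2+pow2≢odd h>0 p a c (halve (trans (2x+1+2z (2 ^ a) (2 ^ c)) eq))
  three (suc a) (suc b) zero eq = pow2+pow2≢odd h>0 p a b (halve (trans (2x+2y+1 (2 ^ a) (2 ^ b)) eq))
  three (suc a) (suc b) (suc c) eq =
    even≢odd (2 ^ a + 2 ^ b + 2 ^ c) (suc (2 * Q)) (trans (2x+2y+2z (2 ^ a) (2 ^ b) (2 ^ c)) eq)

scale : ℕ → ℕ → ℕ
scale r n = (2 ^ r + 1) * 2 ^ n

gen≗pow2Gen : ∀ r n → gen r n ≗ pow2Gen (scale r n)
gen≗pow2Gen r n i = cong (_+ 1) (begin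
  (2 ^ r + 1) * 2 ^ (n + i)     ≡⟨ cong ((2 ^ r + 1) *_) (^-distribˡ-+-* 2 n i) ⟩
  (2 ^ r + 1) * (2 ^ n * 2 ^ i) ≡⟨ *-assoc (2 ^ r + 1) (2 ^ n) (2 ^ i) ⟨
  scale r n * 2 ^ i             ∎)
  where open ≡-Reasoning

frobenius-formula : ∀ r n →
  (2 * gen r n 1 + gen r n n + gen r n (n + r)) ∸ gen r n 0 ≡ 3 + scale r n * (3 + scale r n)
frobenius-formula r n = trans (cong (_∸ gen r n 0) generators-sum) (m+n∸n≡m _ (gen r n 0))
  where
  identity : ∀ a N →
    2 * ((a + 1) * (N * 2) + 1) + ((a + 1) * (N * N) + 1) + ((a + 1) * (N * (N * a)) + 1)
      ≡ 3 + (a + 1) * N * (3 + (a + 1) * N) + ((a + 1) * (N * 1) + 1)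
  identity = solve-∀
  generators-sum : 2 * gen r n 1 + gen r n n + gen r n (n + r)
                   ≡ 3 + scale r n * (3 + scale r n) + gen r n 0
  generators-sum rewrite ^-distribˡ-+-* 2 n 1 | ^-distribˡ-+-* 2 n n | ^-distribˡ-+-* 2 n (n + r)
                       | ^-distribˡ-+-* 2 n r | ^-distribˡ-+-* 2 n 0 = identity (2 ^ r) (2 ^ n)

4≤scale : ∀ r p → 4 ≤ scale r (2 + p)
4≤scale r p = ≤-trans (^-monoʳ-≤ 2 (m≤m+n 2 p))
  (m≤n*m (2 ^ (2 + p)) (2 ^ r + 1) {{>-nonZero (m≤n+m 1 (2 ^ r))}})

pow2Sum-scale : ∀ r n e → Pow2Sum 4 (2 + 2 ^ e + scale r n)
pow2Sum-scale r n e = n + r ∷ n ∷ 1 ∷ e ∷ [] , refl ,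
  trans (cong (_+ (2 ^ n + (2 + (2 ^ e + 0)))) (^-distribˡ-+-* 2 n r))
        (identity (2 ^ r) (2 ^ n) (2 ^ e))
  where
  identity : ∀ a N E → N * a + (N + (2 + (E + 0))) ≡ 2 + E + (a + 1) * N
  identity = solve-∀

¬pow2Sum₃-3+scale : ∀ r p → ¬ Pow2Sum 3 (3 + scale (suc r) (2 + p))
¬pow2Sum₃-3+scale r p =
  subst (λ t → ¬ Pow2Sum 3 t) (sym (odd-form (2 ^ r) (2 ^ p))) (¬pow2Sum₃-odd (m^n>0 2 r) p)
  where
  odd-form : ∀ a P → 3 + (2 * a + 1) * (2 * (2 * P)) ≡ suc (2 * suc (2 * (P * suc (2 * a))))
  odd-form = solve-∀

theorem6 : (n r : ℕ) → 2 < n → 1 ≤ r → 2 ^ r + 1 < 2 ^ n →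
    IsFrobeniusNumber (P r n)
      ((2 * gen r n 1 + gen r n n + gen r n (n + r)) ∸ gen r n 0)
theorem6 n@(suc (suc p)) r@(suc r′) (s≤s (s≤s _)) (s≤s _) _ =
  subst (IsFrobeniusNumber (P r n)) (sym (frobenius-formula r n))
    (IsFrobeniusNumber-≗ (λ i → sym (gen≗pow2Gen r n i))
      (pow2Gen-frobenius (4≤scale r p) (¬pow2Sum₃-3+scale r′ p)
        (pow2Sum-scale r n 0) (pow2Sum-scale r n 1)))
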